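{- Let $\mathcal A\subseteq\binom{[n]}{k}$ be $t$-intersecting. Then for every $1\le i<j\le n$, \[\mathrm{co}_2(\Delta_{ij}(\mathcal A))\ge\mathrm{co}_2(\mathcal A).\] In particular, there exists a left-compressed $t$-intersecting family $\mathcal B\subseteq\binom{[n]}{k}$ such that $\mathrm{co}_2(\mathcal B)\ge\mathrm{co}_2(\mathcal A)$.
   Context: $\binom{[n]}{k}$ is the set of $k$-subsets of $[n]=\{1,\dots,n\}$; $\mathcal A$ is $t$-intersecting if $|A\cap B|\ge t$ for all $A,B\in\mathcal A$. For $E\subseteq[n]$, $d(E)$ is the number of members of the family containing $E$, and $\mathrm{co}_2(\mathcal A)=\sum_{E\in\binom{[n]}{k-1}}d(E)^2$. For $i,j\in[n]$ and $A\in\mathcal A$, $\delta_{ij}(A)=(A\setminus\{j\})\cup\{i\}$ if $j\in A$, $i\notin A$ and $(A\setminus\{j\})\cup\{i\}\notin\mathcal A$, and $\delta_{ij}(A)=A$ otherwise; $\Delta_{ij}(\mathcal A)=\{\delta_{ij}(A):A\in\mathcal A\}$. A family $\mathcal B$ is left-compressed if $\Delta_{ij}(\mathcal B)=\mathcal B$ for all $1\le i<j\le n$. -}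

module Defs where

open import Data.Nat using (ℕ; zero; suc; _≤_; _∸_; _+_; _*_)
open import Data.Bool using (Bool; true; false; _≟_)
open import Data.Fin using (Fin) renaming (_<_ to _<ᶠ_)
open import Data.Fin.Subset using (Subset; ∣_∣; _∩_; _∪_; _-_; ⁅_⁆; _⊆_)
  renaming (_∈_ to _∈ˢ_; _∉_ to _∉ˢ_)
open import Data.Fin.Subset.Properties using (_∈?_; _⊆?_)
open import Data.List using (List; []; _∷_; map; length; filter; _++_)
open import Data.Nat.ListAction using (sum)
open import Data.List.Relation.Unary.All using (All)
open import Data.List.Relation.Unary.Unique.Propositional using (Unique)
open import Data.List.Membership.Propositional using (_∈_)
import Data.List.Membership.DecPropositional as DecMem
open import Data.Vec using (Vec; []; _∷_)
import Data.Vec.Properties as VecP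
open import Data.Product using (_×_)
open import Relation.Nullary using (Dec; yes; no; ¬_)
open import Relation.Binary.PropositionalEquality using (_≡_)
open import Function.Bundles using (_⇔_)

module _ {n : ℕ} where
  open DecMem {A = Subset n} (VecP.≡-dec _≟_) public
    using () renaming (_∈?_ to _∈ᶠ?_)

Family : ℕ → Set
Family n = List (Subset n)

-- 𝒜 ⊆ binom([n], k): a set (no repetitions) of k-element subsets of [n].
IsKUniformFamily : {n : ℕ} → ℕ → Family n → Set
IsKUniformFamily k 𝒜 = Unique 𝒜 × All (λ A → ∣ A ∣ ≡ k) 𝒜

IsTIntersecting : {n : ℕ} → ℕ → Family n → Set
IsTIntersecting t 𝒜 = ∀ {A B} → A ∈ 𝒜 → B ∈ 𝒜 → t ≤ ∣ A ∩ B ∣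

allSubsets : (n : ℕ) → List (Subset n)
allSubsets zero = [] ∷ []
allSubsets (suc n) = map (true ∷_) (allSubsets n) ++ map (false ∷_) (allSubsets n)

subsetsOfSize : (n m : ℕ) → List (Subset n)
subsetsOfSize n m = filter (λ E → ∣ E ∣ Data.Nat.≟ m) (allSubsets n)

deg : {n : ℕ} → Family n → Subset n → ℕ
deg 𝒜 E = length (filter (λ A → E ⊆? A) 𝒜)

co₂ : {n : ℕ} → ℕ → Family n → ℕ
co₂ {n} k 𝒜 = sum (map (λ E → deg 𝒜 E * deg 𝒜 E) (subsetsOfSize n (k ∸ 1)))

δ : {n : ℕ} → Fin n → Fin n → Family n → Subset n → Subset n
δ i j 𝒜 A with j ∈? A | i ∈? A
... | no _  | _     = A
... | yes _ | yes _ = A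
... | yes _ | no _  with ((A - j) ∪ ⁅ i ⁆) ∈ᶠ? 𝒜
...   | yes _ = A
...   | no _  = (A - j) ∪ ⁅ i ⁆

Δ : {n : ℕ} → Fin n → Fin n → Family n → Family n
Δ i j 𝒜 = map (δ i j 𝒜) 𝒜

_≈ᶠ_ : {n : ℕ} → Family n → Family n → Set
𝒜 ≈ᶠ ℬ = ∀ X → (X ∈ 𝒜) ⇔ (X ∈ ℬ)

IsLeftCompressed : {n : ℕ} → Family n → Set
IsLeftCompressed {n} ℬ = ∀ (i j : Fin n) → i <ᶠ j → Δ i j ℬ ≈ᶠ ℬ

-- Let σ swap the coordinates i and j, and let d and d′ be degrees in 𝒜 and in Δᵢⱼ(𝒜).  The shift
-- replaces a moved set A by σA, which exchanges its contributions to the degrees of E and σE, so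
-- d′(E) + d′(σE) = d(E) + d(σE); when σE = E this already gives d′(E) = d(E).  If j ∈ E, a member
-- of Δᵢⱼ(𝒜) containing E was not moved, so it lies in 𝒜 together with its swap; hence
-- d′(E) ≤ min (d(E), d(σE)), and convexity gives d(E)² + d(σE)² ≤ d′(E)² + d′(σE)².  As σ permutes
-- the (k-1)-sets, summing this over all E counts co₂ twice on each side.  This half does not use
-- that 𝒜 is t-intersecting.
-- Shifts preserve k-uniformity and t-intersection, and a shift with i < j that changes the family
-- strictly decreases ∑_{A ∈ 𝒜} ∑_{x ∈ A} x, so repeated shifting ends in a left-compressed family.

module Submission where

open import Defs
open import Data.Nat using (ℕ; _≥_)
open import Data.Fin using (Fin; _<_)
open import Data.Product using (_×_; ∃)

open import Data.Bool.Base using (true; false; if_then_else_)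
import Data.Bool.Properties as Bool
open import Data.Empty using (⊥-elim)
open import Data.Fin.Base using (zero; suc; toℕ)
open import Data.Fin.Properties using (_≟_; _<?_; any?; <⇒≢)
open import Data.Fin.Permutation as Perm using (Permutation; _⟨$⟩ʳ_; _⟨$⟩ˡ_)
import Data.Fin.Permutation.Components as PC
open import Data.Fin.Subset using (Subset; ∣_∣; _∩_; _∪_; _-_; ⁅_⁆; _⊆_)
  renaming (_∈_ to _∈ˢ_; _∉_ to _∉ˢ_)
open import Data.Fin.Subset.Properties
  using (_∈?_; _⊆?_; ⊆-antisym; ∩-comm; p⊆q⇒∣p∣≤∣q∣; x∈p∩q⁺; x∈p∩q⁻; x∈p∪q⁺; x∈p∪q⁻; x∈⁅x⁆;
         x∈⁅y⁆⇒x≡y; x∈p∧x≢y⇒x∈p-y; p─q⊆p)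
open import Data.List.Base using (List; []; _∷_; map; filter; length)
open import Data.List.Membership.Propositional using (_∈_; _∉_)
open import Data.List.Membership.Propositional.Properties
  using (∈-map⁺; ∈-map⁻; ∈-filter⁺; ∈-filter⁻; ∈-++⁺ˡ; ∈-++⁺ʳ)
open import Data.List.Membership.Propositional.Properties.WithK using (unique∧set⇒bag)
import Data.List.Membership.DecPropositional as DecMembership
import Data.List.Properties as List
open import Data.List.Relation.Binary.BagAndSetEquality using (∼bag⇒↭)
open import Data.List.Relation.Binary.Disjoint.Propositional using (Disjoint)
open import Data.List.Relation.Binary.Permutation.Propositional.Properties as ↭ using (↭-length)
open import Data.List.Relation.Unary.All as All using (All)
import Data.List.Relation.Unary.All.Properties as All
open import Data.List.Relation.Unary.Any as Any using (Any; here; there)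
open import Data.List.Relation.Unary.AllPairs using (_∷_; [])
open import Data.List.Relation.Unary.Unique.Propositional using (Unique)
import Data.List.Relation.Unary.Unique.Propositional.Properties as Unique
open import Data.Nat.Base as ℕ using (zero; suc; _+_; _*_; _∸_; _≤_; z≤n)
open import Data.Nat.Induction using (<-wellFounded)
open import Data.Nat.ListAction using (sum)
open import Data.Nat.ListAction.Properties using (sum-↭)
import Data.Nat.Properties as ℕₚ
open import Data.Nat.Solver using (module +-*-Solver)
open +-*-Solver using (solve; _:+_; _:*_; _:=_; con)
open import Algebra.Properties.CommutativeMonoid.Sum ℕₚ.+-0-commutativeMonoid
  using (sum-permute; sum-cong-≗) renaming (sum to ∑)
open import Algebra.Properties.CommutativeSemigroup ℕₚ.+-commutativeSemigroup using (interchange)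
open import Data.Product.Base using (_,_; proj₁; proj₂)
open import Data.Sum.Base using (inj₁; inj₂)
open import Data.Vec.Base using ([]; _∷_; lookup; tabulate; here; there)
import Data.Vec.Properties as Vec
open import Data.Vec.Properties
  using (lookup∘tabulate; tabulate∘lookup; tabulate-cong; lookup⇒[]=; []=⇒lookup)
open import Function.Base using (_∘_; id; const)
open import Function.Bundles using (_⇔_; mk⇔)
open import Induction.WellFounded using (Acc; acc)
open import Relation.Binary.Definitions using (DecidableEquality)
open import Relation.Binary.PropositionalEquality
open import Relation.Nullary.Decidable
  using (Dec; yes; no; does; dec-true; dec-false; does-⇔; _×-dec_; ¬?; decidable-stable)
open import Relation.Nullary.Negation using (¬_; contradiction)
open import Relation.Unary using (Pred; Decidable)

private
  variable
    m n o : ℕ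

m+m≤n+n⇒m≤n : m + m ≤ n + n → m ≤ n
m+m≤n+n⇒m≤n {m} {n} le = subst₂ _≤_ (sym (ℕₚ.n≡⌊n+n/2⌋ m)) (sym (ℕₚ.n≡⌊n+n/2⌋ n)) (ℕₚ.⌊n/2⌋-mono le)

m+m≡n+n⇒m≡n : m + m ≡ n + n → m ≡ n
m+m≡n+n⇒m≡n eq = ℕₚ.≤-antisym (m+m≤n+n⇒m≤n (ℕₚ.≤-reflexive eq)) (m+m≤n+n⇒m≤n (ℕₚ.≤-reflexive (sym eq)))

-- With a = a′ + x and b = a′ + y, the right-hand side exceeds the left-hand side by 2xy.
sum-of-squares-spread : ∀ {a b a′ b′} → a′ + b′ ≡ a + b → a′ ≤ a → a′ ≤ b →
                        a * a + b * b ≤ a′ * a′ + b′ * b′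
sum-of-squares-spread {a} {b} {a′} {b′} sum≡ a′≤a a′≤b = begin
  a * a + b * b                                            ≡⟨ cong₂ (λ u v → u * u + v * v) a≡ b≡ ⟨
  (a′ + x) * (a′ + x) + (a′ + y) * (a′ + y)                ≤⟨ ℕₚ.m≤m+n _ (2 * (x * y)) ⟩
  (a′ + x) * (a′ + x) + (a′ + y) * (a′ + y) + 2 * (x * y)  ≡⟨ expand a′ x y ⟩
  a′ * a′ + (x + (a′ + y)) * (x + (a′ + y))                ≡⟨ cong (λ v → a′ * a′ + v * v) b′≡ ⟨
  a′ * a′ + b′ * b′                                        ∎
  where
  open ℕₚ.≤-Reasoning
  x = a ∸ a′
  y = b ∸ a′
  a≡ : a′ + x ≡ a
  a≡ = ℕₚ.m+[n∸m]≡n a′≤a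
  b≡ : a′ + y ≡ b
  b≡ = ℕₚ.m+[n∸m]≡n a′≤b
  b′≡ : b′ ≡ x + (a′ + y)
  b′≡ = ℕₚ.+-cancelˡ-≡ a′ b′ (x + (a′ + y))
          (trans sum≡ (trans (cong₂ _+_ (sym a≡) (sym b≡)) (ℕₚ.+-assoc a′ x (a′ + y))))
  expand : ∀ a′ x y → (a′ + x) * (a′ + x) + (a′ + y) * (a′ + y) + 2 * (x * y)
                      ≡ a′ * a′ + (x + (a′ + y)) * (x + (a′ + y))
  expand = solve 3 (λ a′ x y → (a′ :+ x) :* (a′ :+ x) :+ (a′ :+ y) :* (a′ :+ y) :+ con 2 :* (x :* y)
                               := a′ :* a′ :+ (x :+ (a′ :+ y)) :* (x :+ (a′ :+ y))) refl

𝟙 : {P : Set} → Dec P → ℕ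
𝟙 p = if does p then 1 else 0

𝟙-⇔ : {P Q : Set} → P ⇔ Q → (p : Dec P) (q : Dec Q) → 𝟙 p ≡ 𝟙 q
𝟙-⇔ P⇔Q p q = cong (if_then 1 else 0) (does-⇔ P⇔Q p q)

module _ {X : Set} where

  length-filter≡sum : {P : Pred X _} (P? : Decidable P) (xs : List X) →
                      length (filter P? xs) ≡ sum (map (𝟙 ∘ P?) xs)
  length-filter≡sum P? [] = refl
  length-filter≡sum P? (x ∷ xs) with does (P? x)
  ... | true = cong suc (length-filter≡sum P? xs)
  ... | false = length-filter≡sum P? xs

  sum-map-+ : (f g : X → ℕ) (xs : List X) →
              sum (map (λ x → f x + g x) xs) ≡ sum (map f xs) + sum (map g xs)
  sum-map-+ f g [] = refl
  sum-map-+ f g (x ∷ xs) = trans (cong (f x + g x +_) (sum-map-+ f g xs))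
                                 (interchange (f x) (g x) (sum (map f xs)) (sum (map g xs)))

  sum-map-mono-≤ : {f g : X → ℕ} → (∀ x → f x ≤ g x) → (xs : List X) → sum (map f xs) ≤ sum (map g xs)
  sum-map-mono-≤ f≤g [] = ℕₚ.≤-refl
  sum-map-mono-≤ f≤g (x ∷ xs) = ℕₚ.+-mono-≤ (f≤g x) (sum-map-mono-≤ f≤g xs)

  sum-map-mono-< : {f g : X → ℕ} → (∀ x → f x ≤ g x) → {xs : List X} →
                   Any (λ x → f x ℕ.< g x) xs → sum (map f xs) ℕ.< sum (map g xs)
  sum-map-mono-< f≤g {_ ∷ xs} (here fx<gx) = ℕₚ.+-mono-<-≤ fx<gx (sum-map-mono-≤ f≤g xs)
  sum-map-mono-< f≤g {x ∷ _} (there any) = ℕₚ.+-mono-≤-< (f≤g x) (sum-map-mono-< f≤g any)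

  count-pair-map : {P Q : Pred X _} (P? : Decidable P) (Q? : Decidable Q) (f : X → X) →
                   (∀ x → 𝟙 (P? (f x)) + 𝟙 (Q? (f x)) ≡ 𝟙 (P? x) + 𝟙 (Q? x)) → (xs : List X) →
                   length (filter P? (map f xs)) + length (filter Q? (map f xs))
                     ≡ length (filter P? xs) + length (filter Q? xs)
  count-pair-map P? Q? f pair xs = begin
    length (filter P? (map f xs)) + length (filter Q? (map f xs))
      ≡⟨ cong₂ _+_ (length-filter≡sum P? (map f xs)) (length-filter≡sum Q? (map f xs)) ⟩
    sum (map (𝟙 ∘ P?) (map f xs)) + sum (map (𝟙 ∘ Q?) (map f xs))
      ≡⟨ cong₂ _+_ (cong sum (List.map-∘ xs)) (cong sum (List.map-∘ xs)) ⟨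
    sum (map (𝟙 ∘ P? ∘ f) xs) + sum (map (𝟙 ∘ Q? ∘ f) xs)
      ≡⟨ sum-map-+ (𝟙 ∘ P? ∘ f) (𝟙 ∘ Q? ∘ f) xs ⟨
    sum (map (λ x → 𝟙 (P? (f x)) + 𝟙 (Q? (f x))) xs)
      ≡⟨ cong sum (List.map-cong pair xs) ⟩
    sum (map (λ x → 𝟙 (P? x) + 𝟙 (Q? x)) xs)
      ≡⟨ sum-map-+ (𝟙 ∘ P?) (𝟙 ∘ Q?) xs ⟩
    sum (map (𝟙 ∘ P?) xs) + sum (map (𝟙 ∘ Q?) xs)
      ≡⟨ cong₂ _+_ (length-filter≡sum P? xs) (length-filter≡sum Q? xs) ⟨
    length (filter P? xs) + length (filter Q? xs)
      ∎
    where open ≡-Reasoning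

  unique-map⁺-local : {Y : Set} {f : X → Y} {xs : List X} →
                      (∀ {x y} → x ∈ xs → y ∈ xs → f x ≡ f y → x ≡ y) → Unique xs → Unique (map f xs)
  unique-map⁺-local {xs = []} _ [] = []
  unique-map⁺-local {xs = x ∷ xs} inj (x∉xs ∷ !xs) =
    All.map⁺ (All.tabulate (λ y∈xs fx≡fy → All.lookup x∉xs y∈xs (inj (here refl) (there y∈xs) fx≡fy)))
    ∷ unique-map⁺-local (λ x∈ y∈ → inj (there x∈) (there y∈)) !xs

  module _ {σ : X → X} (σ-involutive : ∀ x → σ (σ x) ≡ x) {xs : List X}
           (!xs : Unique xs) (σ-closed : ∀ {x} → x ∈ xs → σ x ∈ xs) where

    sum-map-involution : (f : X → ℕ) → sum (map (f ∘ σ) xs) ≡ sum (map f xs)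
    sum-map-involution f = trans (cong sum (List.map-∘ xs)) (sum-↭ (↭.map⁺ f σxs↭xs))
      where
      σ-injective : ∀ {x y} → σ x ≡ σ y → x ≡ y
      σ-injective {x} {y} eq = trans (sym (σ-involutive x)) (trans (cong σ eq) (σ-involutive y))
      σxs⇔xs : ∀ {x} → x ∈ map σ xs ⇔ x ∈ xs
      σxs⇔xs = mk⇔
        (λ x∈σxs → let y , y∈xs , x≡σy = ∈-map⁻ σ x∈σxs in subst (_∈ xs) (sym x≡σy) (σ-closed y∈xs))
        (λ x∈xs → subst (_∈ map σ xs) (σ-involutive _) (∈-map⁺ σ (σ-closed x∈xs)))
      σxs↭xs = ∼bag⇒↭ (unique∧set⇒bag (Unique.map⁺ σ-injective !xs) !xs σxs⇔xs)

    sum-map-pairs : (f : X → ℕ) → sum (map f xs) + sum (map f xs) ≡ sum (map (λ x → f x + f (σ x)) xs)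
    sum-map-pairs f = trans (cong (sum (map f xs) +_) (sym (sum-map-involution f)))
                            (sym (sum-map-+ f (f ∘ σ) xs))

  module _ (_≟ˣ_ : DecidableEquality X) where
    open DecMembership _≟ˣ_ using () renaming (_∈?_ to _∈ˡ?_)

    length-mono-⊆ : {xs ys : List X} → Unique xs → Unique ys → (∀ {x} → x ∈ xs → x ∈ ys) →
                    length xs ≤ length ys
    length-mono-⊆ {xs} {ys} !xs !ys xs⊆ys = begin
      length xs                     ≡⟨ ↭-length (∼bag⇒↭ (unique∧set⇒bag !xs !ys∩xs xs⇔ys∩xs)) ⟩
      length (filter (_∈ˡ? xs) ys)  ≤⟨ List.length-filter (_∈ˡ? xs) ys ⟩
      length ys                     ∎
      where
      open ℕₚ.≤-Reasoning
      !ys∩xs = Unique.filter⁺ (_∈ˡ? xs) !ys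
      xs⇔ys∩xs : ∀ {x} → x ∈ xs ⇔ x ∈ filter (_∈ˡ? xs) ys
      xs⇔ys∩xs = mk⇔ (λ x∈xs → ∈-filter⁺ (_∈ˡ? xs) (xs⊆ys x∈xs) x∈xs)
                     (proj₂ ∘ ∈-filter⁻ (_∈ˡ? xs) {xs = ys})

module _ (i j : Fin n) where

  transpose-matchˡ : PC.transpose i j i ≡ j
  transpose-matchˡ rewrite dec-true (i ≟ i) refl = refl

  transpose-matchʳ : PC.transpose i j j ≡ i
  transpose-matchʳ with j ≟ i
  ... | yes j≡i = j≡i
  ... | no _ rewrite dec-true (j ≟ j) refl = refl

  transpose-unmatched : ∀ {x} → x ≢ i → x ≢ j → PC.transpose i j x ≡ x
  transpose-unmatched {x} x≢i x≢j rewrite dec-false (x ≟ i) x≢i | dec-false (x ≟ j) x≢j = refl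

  transpose-involutive : ∀ x → PC.transpose i j (PC.transpose i j x) ≡ x
  transpose-involutive x = by-cases (x ≟ i) (x ≟ j)
    where
    by-cases : Dec (x ≡ i) → Dec (x ≡ j) → PC.transpose i j (PC.transpose i j x) ≡ x
    by-cases (yes refl) _ = trans (cong (PC.transpose i j) transpose-matchˡ) transpose-matchʳ
    by-cases (no _) (yes refl) = trans (cong (PC.transpose i j) transpose-matchʳ) transpose-matchˡ
    by-cases (no x≢i) (no x≢j) =
      trans (cong (PC.transpose i j) (transpose-unmatched x≢i x≢j)) (transpose-unmatched x≢i x≢j)

preimage : (Fin m → Fin n) → Subset n → Subset m
preimage f A = tabulate (lookup A ∘ f)

module _ (f : Fin m → Fin n) {A : Subset n} where

  ∈-preimage⁺ : ∀ {x} → f x ∈ˢ A → x ∈ˢ preimage f A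
  ∈-preimage⁺ {x} fx∈A = lookup⇒[]= x _ (trans (lookup∘tabulate _ x) ([]=⇒lookup fx∈A))

  ∈-preimage⁻ : ∀ {x} → x ∈ˢ preimage f A → f x ∈ˢ A
  ∈-preimage⁻ {x} x∈ = lookup⇒[]= (f x) A (trans (sym (lookup∘tabulate _ x)) ([]=⇒lookup x∈))

preimage-mono : (f : Fin m → Fin n) {A B : Subset n} → A ⊆ B → preimage f A ⊆ preimage f B
preimage-mono f A⊆B = ∈-preimage⁺ f ∘ A⊆B ∘ ∈-preimage⁻ f

preimage-∩ : (f : Fin m → Fin n) (A B : Subset n) → preimage f (A ∩ B) ≡ preimage f A ∩ preimage f B
preimage-∩ f A B = ⊆-antisym
  (λ x∈ → let xA , xB = x∈p∩q⁻ A B (∈-preimage⁻ f x∈) in x∈p∩q⁺ (∈-preimage⁺ f xA , ∈-preimage⁺ f xB))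
  (λ x∈ → let xA , xB = x∈p∩q⁻ _ _ x∈ in ∈-preimage⁺ f {A ∩ B} (x∈p∩q⁺ (∈-preimage⁻ f xA , ∈-preimage⁻ f xB)))

preimage-∘ : (f : Fin m → Fin n) (g : Fin n → Fin o) (A : Subset o) →
             preimage f (preimage g A) ≡ preimage (g ∘ f) A
preimage-∘ f g A = tabulate-cong (λ x → lookup∘tabulate _ (f x))

preimage-cong : {f g : Fin m → Fin n} → f ≗ g → (A : Subset n) → preimage f A ≡ preimage g A
preimage-cong f≗g A = tabulate-cong (cong (lookup A) ∘ f≗g)

preimage-id : (A : Subset n) → preimage id A ≡ A
preimage-id = tabulate∘lookup

weight : (Fin n → ℕ) → Subset n → ℕ
weight w A = ∑ (λ x → if lookup A x then w x else 0)

∣∣≡weight : (A : Subset n) → ∣ A ∣ ≡ weight (const 1) A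
∣∣≡weight [] = refl
∣∣≡weight (true ∷ A) = cong suc (∣∣≡weight A)
∣∣≡weight (false ∷ A) = ∣∣≡weight A

weight-preimage : (π : Permutation m n) (w : Fin m → ℕ) (A : Subset n) →
                  weight w (preimage (π ⟨$⟩ʳ_) A) ≡ weight (w ∘ (π ⟨$⟩ˡ_)) A
weight-preimage π w A = begin
  ∑ (λ x → if lookup (preimage (π ⟨$⟩ʳ_) A) x then w x else 0)
    ≡⟨ sum-cong-≗ (λ x → cong (if_then w x else 0) (lookup∘tabulate _ x)) ⟩
  ∑ (λ x → if lookup A (π ⟨$⟩ʳ x) then w x else 0)
    ≡⟨ sum-permute _ (Perm.flip π) ⟩
  ∑ (λ y → if lookup A (π ⟨$⟩ʳ (π ⟨$⟩ˡ y)) then w (π ⟨$⟩ˡ y) else 0)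
    ≡⟨ sum-cong-≗ (λ y → cong (if_then w (π ⟨$⟩ˡ y) else 0) (cong (lookup A) (Perm.inverseʳ π))) ⟩
  ∑ (λ y → if lookup A y then w (π ⟨$⟩ˡ y) else 0)
    ∎
  where open ≡-Reasoning

∣preimage∣ : (π : Permutation m n) (A : Subset n) → ∣ preimage (π ⟨$⟩ʳ_) A ∣ ≡ ∣ A ∣
∣preimage∣ π A = begin
  ∣ preimage (π ⟨$⟩ʳ_) A ∣                 ≡⟨ ∣∣≡weight (preimage (π ⟨$⟩ʳ_) A) ⟩
  weight (const 1) (preimage (π ⟨$⟩ʳ_) A)  ≡⟨ weight-preimage π (const 1) A ⟩
  weight (const 1) A                       ≡⟨ ∣∣≡weight A ⟨
  ∣ A ∣                                    ∎
  where open ≡-Reasoning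

weight-mono-≤ : {v w : Fin n → ℕ} {A : Subset n} → (∀ {x} → x ∈ˢ A → v x ≤ w x) → weight v A ≤ weight w A
weight-mono-≤ {A = []} _ = z≤n
weight-mono-≤ {A = true ∷ A} v≤w = ℕₚ.+-mono-≤ (v≤w here) (weight-mono-≤ (v≤w ∘ there))
weight-mono-≤ {A = false ∷ A} v≤w = weight-mono-≤ (v≤w ∘ there)

weight-mono-< : {v w : Fin n → ℕ} {A : Subset n} → (∀ {x} → x ∈ˢ A → v x ≤ w x) →
                ∀ {x} → x ∈ˢ A → v x ℕ.< w x → weight v A ℕ.< weight w A
weight-mono-< {A = _ ∷ A} v≤w here v<w = ℕₚ.+-mono-<-≤ v<w (weight-mono-≤ (v≤w ∘ there))
weight-mono-< {A = true ∷ A} v≤w (there x∈A) v<w =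
  ℕₚ.+-mono-≤-< (v≤w here) (weight-mono-< (v≤w ∘ there) x∈A v<w)
weight-mono-< {A = false ∷ A} v≤w (there x∈A) v<w = weight-mono-< (v≤w ∘ there) x∈A v<w

x∉p-x : (p : Subset n) (x : Fin n) → x ∉ˢ p - x
x∉p-x (true ∷ p) zero ()
x∉p-x (false ∷ p) zero ()
x∉p-x (_ ∷ p) (suc x) (there x∈) = x∉p-x p x x∈

swap : Fin n → Fin n → Subset n → Subset n
swap i j = preimage (PC.transpose i j)

module _ (i j : Fin n) where

  swap-involutive : (A : Subset n) → swap i j (swap i j A) ≡ A
  swap-involutive A = begin
    swap i j (swap i j A)                             ≡⟨ preimage-∘ (PC.transpose i j) (PC.transpose i j) A ⟩
    preimage (PC.transpose i j ∘ PC.transpose i j) A  ≡⟨ preimage-cong (transpose-involutive i j) A ⟩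
    preimage id A                                     ≡⟨ preimage-id A ⟩
    A                                                 ∎
    where open ≡-Reasoning

  swap-injective : ∀ {A B} → swap i j A ≡ swap i j B → A ≡ B
  swap-injective {A} {B} eq =
    trans (sym (swap-involutive A)) (trans (cong (swap i j) eq) (swap-involutive B))

  ∣swap∣ : (A : Subset n) → ∣ swap i j A ∣ ≡ ∣ A ∣
  ∣swap∣ = ∣preimage∣ (Perm.transpose i j)

  swap-∩ : (A B : Subset n) → swap i j (A ∩ B) ≡ swap i j A ∩ swap i j B
  swap-∩ = preimage-∩ (PC.transpose i j)

  ∣swap-∩∣ : (A B : Subset n) → ∣ swap i j A ∩ B ∣ ≡ ∣ A ∩ swap i j B ∣
  ∣swap-∩∣ A B = begin
    ∣ swap i j A ∩ B ∣                      ≡⟨ cong (λ C → ∣ swap i j A ∩ C ∣) (swap-involutive B) ⟨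
    ∣ swap i j A ∩ swap i j (swap i j B) ∣  ≡⟨ cong ∣_∣ (swap-∩ A (swap i j B)) ⟨
    ∣ swap i j (A ∩ swap i j B) ∣           ≡⟨ ∣swap∣ (A ∩ swap i j B) ⟩
    ∣ A ∩ swap i j B ∣                      ∎
    where open ≡-Reasoning

  swap-⊆ : ∀ {A B} → A ⊆ B → swap i j A ⊆ swap i j B
  swap-⊆ = preimage-mono (PC.transpose i j)

  ⊆-swap⇔ : ∀ {E A} → E ⊆ swap i j A ⇔ swap i j E ⊆ A
  ⊆-swap⇔ {E} {A} = mk⇔
    (subst (swap i j E ⊆_) (swap-involutive A) ∘ swap-⊆)
    (subst (_⊆ swap i j A) (swap-involutive E) ∘ swap-⊆)

  swap-⊆-swap⇔ : ∀ {E A} → swap i j E ⊆ swap i j A ⇔ E ⊆ A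
  swap-⊆-swap⇔ {E} {A} = mk⇔ (subst₂ _⊆_ (swap-involutive E) (swap-involutive A) ∘ swap-⊆) swap-⊆

  swap-fixes : ∀ {A} → lookup A i ≡ lookup A j → swap i j A ≡ A
  swap-fixes {A} Aᵢ≡Aⱼ = trans (tabulate-cong (λ x → by-cases x (x ≟ i) (x ≟ j))) (tabulate∘lookup A)
    where
    by-cases : ∀ x → Dec (x ≡ i) → Dec (x ≡ j) → lookup A (PC.transpose i j x) ≡ lookup A x
    by-cases x (yes refl) _ = trans (cong (lookup A) (transpose-matchˡ i j)) (sym Aᵢ≡Aⱼ)
    by-cases x (no _) (yes refl) = trans (cong (lookup A) (transpose-matchʳ i j)) Aᵢ≡Aⱼ
    by-cases x (no x≢i) (no x≢j) = cong (lookup A) (transpose-unmatched i j x≢i x≢j)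

  ∈-swap-unmatched : ∀ {A x} → x ≢ i → x ≢ j → x ∈ˢ A → x ∈ˢ swap i j A
  ∈-swap-unmatched {A} x≢i x≢j x∈A =
    ∈-preimage⁺ _ (subst (_∈ˢ A) (sym (transpose-unmatched i j x≢i x≢j)) x∈A)

  j∈swap : ∀ {A} → i ∈ˢ A → j ∈ˢ swap i j A
  j∈swap {A} i∈A = ∈-preimage⁺ _ (subst (_∈ˢ A) (sym (transpose-matchʳ i j)) i∈A)

  j∉swap : ∀ {A} → i ∉ˢ A → j ∉ˢ swap i j A
  j∉swap i∉A j∈ = i∉A (subst (_∈ˢ _) (transpose-matchʳ i j) (∈-preimage⁻ _ j∈))

  swap-shift : ∀ {A} → i ≢ j → j ∈ˢ A → i ∉ˢ A → (A - j) ∪ ⁅ i ⁆ ≡ swap i j A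
  swap-shift {A} i≢j j∈A i∉A = ⊆-antisym shifted⊆swap swap⊆shifted
    where
    shifted⊆swap : (A - j) ∪ ⁅ i ⁆ ⊆ swap i j A
    shifted⊆swap x∈ with x∈p∪q⁻ (A - j) ⁅ i ⁆ x∈
    ... | inj₁ x∈A-j = ∈-swap-unmatched (λ { refl → i∉A x∈A }) (λ { refl → x∉p-x A j x∈A-j }) x∈A
      where x∈A = p─q⊆p A ⁅ j ⁆ x∈A-j
    ... | inj₂ x∈⁅i⁆ rewrite x∈⁅y⁆⇒x≡y i x∈⁅i⁆ =
      ∈-preimage⁺ _ (subst (_∈ˢ A) (sym (transpose-matchˡ i j)) j∈A)
    swap⊆shifted : swap i j A ⊆ (A - j) ∪ ⁅ i ⁆
    swap⊆shifted {x} x∈ = by-cases (x ≟ i) (x ≟ j)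
      where
      τx∈A = ∈-preimage⁻ _ x∈
      by-cases : Dec (x ≡ i) → Dec (x ≡ j) → x ∈ˢ (A - j) ∪ ⁅ i ⁆
      by-cases (yes refl) _ = x∈p∪q⁺ (inj₂ (x∈⁅x⁆ x))
      by-cases (no _) (yes refl) = ⊥-elim (i∉A (subst (_∈ˢ A) (transpose-matchʳ i j) τx∈A))
      by-cases (no x≢i) (no x≢j) =
        x∈p∪q⁺ (inj₁ (x∈p∧x≢y⇒x∈p-y (subst (_∈ˢ A) (transpose-unmatched i j x≢i x≢j) τx∈A) x≢j))

wt : Subset n → ℕ
wt = weight toℕ

wt-swap-< : {i j : Fin n} {A : Subset n} → i < j → j ∈ˢ A → i ∉ˢ A → wt (swap i j A) ℕ.< wt A
wt-swap-< {i = i} {j} {A} i<j j∈A i∉A = begin-strict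
  wt (swap i j A)                    ≡⟨ weight-preimage (Perm.transpose i j) toℕ A ⟩
  weight (toℕ ∘ PC.transpose j i) A  <⟨ weight-mono-< moves-down j∈A j-moves-down ⟩
  wt A                               ∎
  where
  open ℕₚ.≤-Reasoning
  j-moves-down : toℕ (PC.transpose j i j) ℕ.< toℕ j
  j-moves-down = subst (λ x → toℕ x ℕ.< toℕ j) (sym (transpose-matchˡ j i)) i<j
  moves-down : ∀ {x} → x ∈ˢ A → toℕ (PC.transpose j i x) ≤ toℕ x
  moves-down {x} x∈A = by-cases (x ≟ j) (x ≟ i)
    where
    by-cases : Dec (x ≡ j) → Dec (x ≡ i) → toℕ (PC.transpose j i x) ≤ toℕ x
    by-cases (yes refl) _ = ℕₚ.<⇒≤ j-moves-down
    by-cases (no _) (yes refl) = contradiction x∈A i∉A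
    by-cases (no x≢j) (no x≢i) = ℕₚ.≤-reflexive (cong toℕ (transpose-unmatched j i x≢j x≢i))

familyWt : Family n → ℕ
familyWt F = sum (map wt F)

_≟ˢ_ : DecidableEquality (Subset n)
_≟ˢ_ = Vec.≡-dec Bool._≟_

∈-allSubsets : (E : Subset n) → E ∈ allSubsets n
∈-allSubsets [] = here refl
∈-allSubsets (true ∷ E) = ∈-++⁺ˡ (∈-map⁺ (true ∷_) (∈-allSubsets E))
∈-allSubsets (false ∷ E) = ∈-++⁺ʳ _ (∈-map⁺ (false ∷_) (∈-allSubsets E))

allSubsets-unique : ∀ n → Unique (allSubsets n)
allSubsets-unique zero = All.[] ∷ []
allSubsets-unique (suc n) =
  Unique.++⁺ (Unique.map⁺ Vec.∷-injectiveʳ !all) (Unique.map⁺ Vec.∷-injectiveʳ !all) heads-differ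
  where
  !all = allSubsets-unique n
  heads-differ : Disjoint (map (true ∷_) (allSubsets n)) (map (false ∷_) (allSubsets n))
  heads-differ (∈true , ∈false) with ∈-map⁻ (true ∷_) ∈true | ∈-map⁻ (false ∷_) ∈false
  ... | _ , _ , refl | _ , _ , ()

subsetsOfSize-unique : ∀ n m → Unique (subsetsOfSize n m)
subsetsOfSize-unique n m = Unique.filter⁺ _ (allSubsets-unique n)

swap-subsetsOfSize : (i j : Fin n) {E : Subset n} → E ∈ subsetsOfSize n m → swap i j E ∈ subsetsOfSize n m
swap-subsetsOfSize {n} {m} i j {E} E∈ =
  ∈-filter⁺ size≟m (∈-allSubsets (swap i j E))
            (trans (∣swap∣ i j E) (proj₂ (∈-filter⁻ size≟m {xs = allSubsets n} E∈)))
  where size≟m = λ (E : Subset n) → ∣ E ∣ ℕₚ.≟ m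

deg² : Family n → Subset n → ℕ
deg² F E = deg F E * deg F E

module Shift (i j : Fin n) (i≢j : i ≢ j) (F : Family n) where

  data View (A : Subset n) : Subset n → Set where
    moved : j ∈ˢ A → i ∉ˢ A → swap i j A ∉ F → View A (swap i j A)
    kept  : (j ∈ˢ A → i ∉ˢ A → swap i j A ∈ F) → View A A

  view : (A : Subset n) → View A (δ i j F A)
  view A with j ∈? A | i ∈? A
  ... | no j∉A | _ = kept (λ j∈A → contradiction j∈A j∉A)
  ... | yes _ | yes i∈A = kept (λ _ i∉A → contradiction i∈A i∉A)
  ... | yes j∈A | no i∉A with ((A - j) ∪ ⁅ i ⁆) ∈ᶠ? F
  ...   | yes shifted∈F = kept (λ _ _ → subst (_∈ F) shifted≡swap shifted∈F)
    where shifted≡swap = swap-shift i j i≢j j∈A i∉A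
  ...   | no shifted∉F =
    subst (View A) (sym shifted≡swap) (moved j∈A i∉A (shifted∉F ∘ subst (_∈ F) (sym shifted≡swap)))
    where shifted≡swap = swap-shift i j i≢j j∈A i∉A

  kept-swap∈F : ∀ {A} → A ∈ F → (j ∈ˢ A → i ∉ˢ A → swap i j A ∈ F) → j ∈ˢ A → swap i j A ∈ F
  kept-swap∈F {A} A∈F shift∈F j∈A with i ∈? A
  ... | yes i∈A = subst (_∈ F) (sym (swap-fixes i j (trans ([]=⇒lookup i∈A) (sym ([]=⇒lookup j∈A))))) A∈F
  ... | no i∉A = shift∈F j∈A i∉A

  ∣δ∣ : ∀ A → ∣ δ i j F A ∣ ≡ ∣ A ∣
  ∣δ∣ A with δ i j F A | view A
  ... | _ | moved _ _ _ = ∣swap∣ i j A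
  ... | _ | kept _ = refl

  δ-injective : ∀ {A B} → A ∈ F → B ∈ F → δ i j F A ≡ δ i j F B → A ≡ B
  δ-injective {A} {B} A∈F B∈F with δ i j F A | view A | δ i j F B | view B
  ... | _ | moved _ _ _ | _ | moved _ _ _ = swap-injective i j
  ... | _ | moved _ _ σA∉F | _ | kept _ = λ σA≡B → contradiction (subst (_∈ F) (sym σA≡B) B∈F) σA∉F
  ... | _ | kept _ | _ | moved _ _ σB∉F = λ A≡σB → contradiction (subst (_∈ F) A≡σB A∈F) σB∉F
  ... | _ | kept _ | _ | kept _ = id

  Δ-unique : Unique F → Unique (Δ i j F)
  Δ-unique = unique-map⁺-local δ-injective

  Δ-uniform : ∀ {k} → All (λ A → ∣ A ∣ ≡ k) F → All (λ A → ∣ A ∣ ≡ k) (Δ i j F)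
  Δ-uniform = All.map⁺ ∘ All.map (λ {A} → trans (∣δ∣ A))

  Δ-∋j : ∀ {B} → B ∈ Δ i j F → j ∈ˢ B → B ∈ F × swap i j B ∈ F
  Δ-∋j B∈Δ j∈B with ∈-map⁻ (δ i j F) B∈Δ
  ... | A , A∈F , refl with δ i j F A | view A
  ...   | _ | moved _ i∉A _ = contradiction j∈B (j∉swap i j i∉A)
  ...   | _ | kept shift∈F = A∈F , kept-swap∈F A∈F shift∈F j∈B

  module _ {t : ℕ} (tF : IsTIntersecting t F) where

    moved-∩-intersecting : ∀ {A B} → A ∈ F → j ∈ˢ A → i ∉ˢ A → B ∈ F → (j ∈ˢ B → swap i j B ∈ F) →
                           t ≤ ∣ swap i j A ∩ B ∣
    moved-∩-intersecting {A} {B} A∈F j∈A i∉A B∈F σB∈F with j ∈? B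
    ... | yes j∈B = subst (t ≤_) (sym (∣swap-∩∣ i j A B)) (tF A∈F (σB∈F j∈B))
    ... | no j∉B = ℕₚ.≤-trans (tF A∈F B∈F) (p⊆q⇒∣p∣≤∣q∣ A∩B⊆σA∩B)
      where
      A∩B⊆σA∩B : A ∩ B ⊆ swap i j A ∩ B
      A∩B⊆σA∩B x∈A∩B with x∈p∩q⁻ A B x∈A∩B
      ... | x∈A , x∈B = x∈p∩q⁺ (∈-swap-unmatched i j (λ { refl → i∉A x∈A }) (λ { refl → j∉B x∈B }) x∈A , x∈B)

    Δ-intersecting : IsTIntersecting t (Δ i j F)
    Δ-intersecting C∈Δ D∈Δ with ∈-map⁻ (δ i j F) C∈Δ | ∈-map⁻ (δ i j F) D∈Δ
    ... | A , A∈F , refl | B , B∈F , refl with δ i j F A | view A | δ i j F B | view B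
    ...   | _ | moved _ _ _ | _ | moved _ _ _ =
      subst (t ≤_) (trans (sym (∣swap∣ i j (A ∩ B))) (cong ∣_∣ (swap-∩ i j A B))) (tF A∈F B∈F)
    ...   | _ | moved j∈A i∉A _ | _ | kept B-kept =
      moved-∩-intersecting A∈F j∈A i∉A B∈F (kept-swap∈F B∈F B-kept)
    ...   | _ | kept A-kept | _ | moved j∈B i∉B _ =
      subst (t ≤_) (cong ∣_∣ (∩-comm (swap i j B) A))
            (moved-∩-intersecting B∈F j∈B i∉B A∈F (kept-swap∈F A∈F A-kept))
    ...   | _ | kept _ | _ | kept _ = tF A∈F B∈F

  deg-Δ-pair : ∀ E → deg (Δ i j F) E + deg (Δ i j F) (swap i j E) ≡ deg F E + deg F (swap i j E)
  deg-Δ-pair E = count-pair-map (E ⊆?_) (swap i j E ⊆?_) (δ i j F) pair F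
    where
    pair : ∀ A → 𝟙 (E ⊆? δ i j F A) + 𝟙 (swap i j E ⊆? δ i j F A) ≡ 𝟙 (E ⊆? A) + 𝟙 (swap i j E ⊆? A)
    pair A with δ i j F A | view A
    ... | _ | moved _ _ _ = trans (cong₂ _+_ (𝟙-⇔ (⊆-swap⇔ i j) (E ⊆? swap i j A) (swap i j E ⊆? A))
                                             (𝟙-⇔ (swap-⊆-swap⇔ i j) (swap i j E ⊆? swap i j A) (E ⊆? A)))
                                  (ℕₚ.+-comm (𝟙 (swap i j E ⊆? A)) (𝟙 (E ⊆? A)))
    ... | _ | kept _ = refl

  deg-Δ-fixed : ∀ {E} → swap i j E ≡ E → deg (Δ i j F) E ≡ deg F E
  deg-Δ-fixed {E} σE≡E =
    m+m≡n+n⇒m≡n (subst (λ X → deg (Δ i j F) E + deg (Δ i j F) X ≡ deg F E + deg F X) σE≡E (deg-Δ-pair E))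

  module _ (!F : Unique F) where

    private
      !Δ = Δ-unique !F

    deg-Δ-≤ : ∀ {E} → j ∈ˢ E → deg (Δ i j F) E ≤ deg F E
    deg-Δ-≤ {E} j∈E = length-mono-⊆ _≟ˢ_ (Unique.filter⁺ _ !Δ) (Unique.filter⁺ _ !F) kept∈F
      where
      kept∈F : ∀ {B} → B ∈ filter (E ⊆?_) (Δ i j F) → B ∈ filter (E ⊆?_) F
      kept∈F B∈ with ∈-filter⁻ (E ⊆?_) {xs = Δ i j F} B∈
      ... | B∈Δ , E⊆B = ∈-filter⁺ (E ⊆?_) (proj₁ (Δ-∋j B∈Δ (E⊆B j∈E))) E⊆B

    deg-Δ-≤-swap : ∀ {E} → j ∈ˢ E → deg (Δ i j F) E ≤ deg F (swap i j E)
    deg-Δ-≤-swap {E} j∈E = begin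
      deg (Δ i j F) E                                     ≡⟨ List.length-map (swap i j) E-sets ⟨
      length (map (swap i j) E-sets)                      ≤⟨ length-mono-⊆ _≟ˢ_ !swapped !σE-sets swapped∈F ⟩
      deg F (swap i j E)                                  ∎
      where
      open ℕₚ.≤-Reasoning
      E-sets = filter (E ⊆?_) (Δ i j F)
      !swapped = Unique.map⁺ (swap-injective i j) (Unique.filter⁺ (E ⊆?_) !Δ)
      !σE-sets = Unique.filter⁺ (swap i j E ⊆?_) !F
      swapped∈F : ∀ {X} → X ∈ map (swap i j) E-sets → X ∈ filter (swap i j E ⊆?_) F
      swapped∈F X∈ with ∈-map⁻ (swap i j) X∈
      ... | B , B∈ , refl with ∈-filter⁻ (E ⊆?_) {xs = Δ i j F} B∈
      ...   | B∈Δ , E⊆B = ∈-filter⁺ (swap i j E ⊆?_) (proj₂ (Δ-∋j B∈Δ (E⊆B j∈E))) (swap-⊆ i j E⊆B)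

    deg²-pair-fixed : ∀ {E} → lookup E i ≡ lookup E j →
                      deg² F E + deg² F (swap i j E) ≤ deg² (Δ i j F) E + deg² (Δ i j F) (swap i j E)
    deg²-pair-fixed {E} Eᵢ≡Eⱼ =
      subst (λ X → deg² F E + deg² F X ≤ deg² (Δ i j F) E + deg² (Δ i j F) X) (sym σE≡E)
            (ℕₚ.≤-reflexive (cong (λ d → d * d + d * d) (sym (deg-Δ-fixed σE≡E))))
      where σE≡E = swap-fixes i j Eᵢ≡Eⱼ

    deg²-pair-spread : ∀ {E} → j ∈ˢ E →
                       deg² F E + deg² F (swap i j E) ≤ deg² (Δ i j F) E + deg² (Δ i j F) (swap i j E)
    deg²-pair-spread j∈E = sum-of-squares-spread (deg-Δ-pair _) (deg-Δ-≤ j∈E) (deg-Δ-≤-swap j∈E)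

    deg²-pair-≤ : ∀ E → deg² F E + deg² F (swap i j E) ≤ deg² (Δ i j F) E + deg² (Δ i j F) (swap i j E)
    deg²-pair-≤ E with lookup E i in Eᵢ | lookup E j in Eⱼ
    ... | true  | true  = deg²-pair-fixed (trans Eᵢ (sym Eⱼ))
    ... | false | false = deg²-pair-fixed (trans Eᵢ (sym Eⱼ))
    ... | false | true  = deg²-pair-spread (lookup⇒[]= j E Eⱼ)
    ... | true  | false =
      subst₂ _≤_ (pair-comm F) (pair-comm (Δ i j F)) (deg²-pair-spread (j∈swap i j (lookup⇒[]= i E Eᵢ)))
      where
      pair-comm : ∀ G → deg² G (swap i j E) + deg² G (swap i j (swap i j E)) ≡ deg² G E + deg² G (swap i j E)
      pair-comm G = trans (cong (λ X → deg² G (swap i j E) + deg² G X) (swap-involutive i j E))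
                          (ℕₚ.+-comm (deg² G (swap i j E)) (deg² G E))

    co₂-Δ-≥ : ∀ k → co₂ k (Δ i j F) ≥ co₂ k F
    co₂-Δ-≥ k = m+m≤n+n⇒m≤n (begin
      co₂ k F + co₂ k F                                                    ≡⟨ pairs F ⟩
      sum (map (λ E → deg² F E + deg² F (swap i j E)) L)                   ≤⟨ sum-map-mono-≤ deg²-pair-≤ L ⟩
      sum (map (λ E → deg² (Δ i j F) E + deg² (Δ i j F) (swap i j E)) L)  ≡⟨ pairs (Δ i j F) ⟨
      co₂ k (Δ i j F) + co₂ k (Δ i j F)                                    ∎)
      where
      open ℕₚ.≤-Reasoning
      L = subsetsOfSize n (k ∸ 1)
      pairs : ∀ G → co₂ k G + co₂ k G ≡ sum (map (λ E → deg² G E + deg² G (swap i j E)) L)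
      pairs G = sum-map-pairs (swap-involutive i j) (subsetsOfSize-unique n (k ∸ 1))
                              (swap-subsetsOfSize i j) (deg² G)

  module _ (i<j : i < j) where

    wt-δ-≤ : ∀ A → wt (δ i j F A) ≤ wt A
    wt-δ-≤ A with δ i j F A | view A
    ... | _ | moved j∈A i∉A _ = ℕₚ.<⇒≤ (wt-swap-< i<j j∈A i∉A)
    ... | _ | kept _ = ℕₚ.≤-refl

    wt-δ-< : ∀ A → δ i j F A ≢ A → wt (δ i j F A) ℕ.< wt A
    wt-δ-< A with δ i j F A | view A
    ... | _ | moved j∈A i∉A _ = λ _ → wt-swap-< i<j j∈A i∉A
    ... | _ | kept _ = λ δA≢A → contradiction refl δA≢A

    familyWt-Δ-< : Δ i j F ≢ F → familyWt (Δ i j F) ℕ.< familyWt F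
    familyWt-Δ-< Δ≢F =
      subst (ℕ._< familyWt F) (cong sum (List.map-∘ F))
            (sum-map-mono-< wt-δ-≤ (Any.map (wt-δ-< _) some-moved))
      where
      some-moved : Any (λ A → δ i j F A ≢ A) F
      some-moved = All.¬All⇒Any¬ (λ A → δ i j F A ≟ˢ A) F (Δ≢F ∘ List.map-id-local)

Compressible : Family n → Set
Compressible {n} F = ∃ λ (i : Fin n) → ∃ λ (j : Fin n) → i < j × Δ i j F ≢ F

compressible? : (F : Family n) → Dec (Compressible F)
compressible? F = any? λ i → any? λ j → (i <? j) ×-dec ¬? (List.≡-dec _≟ˢ_ (Δ i j F) F)

incompressible⇒leftCompressed : {F : Family n} → ¬ Compressible F → IsLeftCompressed F
incompressible⇒leftCompressed {F = F} ¬c i j i<j X = subst (λ G → (X ∈ G) ⇔ (X ∈ F)) (sym Δ≡F) (mk⇔ id id)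
  where Δ≡F = decidable-stable (List.≡-dec _≟ˢ_ (Δ i j F) F) (λ Δ≢F → ¬c (i , j , i<j , Δ≢F))

left-compression : {k t : ℕ} (F : Family n) → Acc ℕ._<_ (familyWt F) →
                   IsKUniformFamily k F → IsTIntersecting t F →
                   ∃ (λ (ℬ : Family n) → IsKUniformFamily k ℬ × IsTIntersecting t ℬ
                                         × IsLeftCompressed ℬ × co₂ k ℬ ≥ co₂ k F)
left-compression F _ kF tF with compressible? F
... | no ¬c = F , kF , tF , incompressible⇒leftCompressed ¬c , ℕₚ.≤-refl
left-compression {k = k} F (acc smaller) (!F , uF) tF | yes (i , j , i<j , Δ≢F) =
  let ℬ , kℬ , tℬ , cℬ , co₂ℬ≥co₂Δ = left-compression (Δ i j F) (smaller (familyWt-Δ-< i<j Δ≢F))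
                                                      (Δ-unique !F , Δ-uniform uF) (Δ-intersecting tF)
  in ℬ , kℬ , tℬ , cℬ , ℕₚ.≤-trans (co₂-Δ-≥ !F k) co₂ℬ≥co₂Δ
  where open Shift i j (<⇒≢ i<j) F

corollary1 : (n k t : ℕ) (𝒜 : Family n) → IsKUniformFamily k 𝒜 → IsTIntersecting t 𝒜 →
      ((i j : Fin n) → i < j → co₂ k (Δ i j 𝒜) ≥ co₂ k 𝒜)
    × ∃ (λ (ℬ : Family n) → IsKUniformFamily k ℬ × IsTIntersecting t ℬ
                            × IsLeftCompressed ℬ × co₂ k ℬ ≥ co₂ k 𝒜)
corollary1 n k t 𝒜 k𝒜@(!𝒜 , _) t𝒜 =
  (λ i j i<j → Shift.co₂-Δ-≥ i j (<⇒≢ i<j) 𝒜 !𝒜 k) ,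
  left-compression 𝒜 (<-wellFounded (familyWt 𝒜)) k𝒜 t𝒜
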